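{- There is a constant $c>0$ such that for all $n\ge 2$, the Boolean lattice $2^{[n]}$ has at least $2^{c\,2^{n}/\sqrt{n}}$ symmetric chain decompositions.
   Context: $2^{[n]}$ is the power set of $[n]=\{1,\dots,n\}$ ordered by inclusion. A chain $c_0\subset\dots\subset c_k$ in $2^{[n]}$ is symmetric if $|c_i|=(n-k)/2+i$ for $i=0,\dots,k$. A symmetric chain decomposition is a partition of $2^{[n]}$ into symmetric chains. -}

module Defs where

open import Data.Nat using (ℕ; zero; suc; _+_; _*_; _≤_; _<_; _^_)
open import Data.List using (List; []; _∷_; length; concat)
open import Data.List.Relation.Unary.All using (All)
open import Data.List.Relation.Unary.Unique.Propositional using (Unique)
open import Data.List.Relation.Unary.AllPairs using (AllPairs)
open import Data.List.Membership.Propositional using (_∈_)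
open import Data.Fin.Subset using (Subset; _⊂_; ∣_∣)
open import Data.Product using (_×_; Σ; ∃; _,_)
open import Data.Unit using (⊤)
open import Data.Empty using (⊥)
open import Relation.Nullary using (¬_)
open import Relation.Binary.PropositionalEquality using (_≡_)
open import Function.Bundles using (_⇔_)

IsChain : ∀ {n} → List (Subset n) → Set
IsChain [] = ⊤
IsChain (x ∷ []) = ⊤
IsChain (x ∷ y ∷ xs) = x ⊂ y × IsChain (y ∷ xs)

-- |cᵢ| = (n - k)/2 + i for all i, written without division/subtraction as
-- 2·|cᵢ| + k = n + 2·i, where the chain is c₀,…,c_k (so k + 1 = length).
SizesFrom : ∀ {n} → ℕ → ℕ → List (Subset n) → Set
SizesFrom {n} k i [] = ⊤
SizesFrom {n} k i (c ∷ cs) = (2 * ∣ c ∣ + k ≡ n + 2 * i) × SizesFrom k (suc i) cs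

IsSymmetricChain : ∀ {n} → List (Subset n) → Set
IsSymmetricChain [] = ⊥
IsSymmetricChain {n} (c ∷ cs) =
  IsChain (c ∷ cs) × SizesFrom {n} (length cs) 0 (c ∷ cs)

IsSCD : ∀ {n} → List (List (Subset n)) → Set
IsSCD {n} D =
  All IsSymmetricChain D × Unique (concat D) × (∀ (X : Subset n) → X ∈ concat D)

-- Two decompositions are the same iff they consist of the same chains
-- (a decomposition is a set of chains; list order is irrelevant).
SameDecomposition : ∀ {n} → List (List (Subset n)) → List (List (Subset n)) → Set
SameDecomposition D E = ∀ C → (C ∈ D) ⇔ (C ∈ E)

DistinctSCDs : ∀ {n} → List (List (List (Subset n))) → Set
DistinctSCDs Ds = All IsSCD Ds × AllPairs (λ D E → ¬ SameDecomposition D E) Ds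

module Submission where

-- Write 2^[m+1] as two copies of 2^[m]: a subset x of [m] gives x⁰ = x and x¹ = x ∪ {new point}
-- (the new point is the first coordinate of a 'Subset (suc m)').  For a symmetric chain
-- C = c₀ ⊂ … ⊂ c_k of 2^[m] the prism C⁰ ∪ C¹ splits into two symmetric chains of 2^[m+1]
-- in two ways:
--   standard:  c₀⁰ ⊂ c₁⁰ ⊂ … ⊂ c_k⁰ ⊂ c_k¹   and   c₀¹ ⊂ … ⊂ c_{k-1}¹,
--   twisted:   c₀⁰ ⊂ c₀¹ ⊂ c₁¹ ⊂ … ⊂ c_k¹   and   c₁⁰ ⊂ … ⊂ c_k⁰        (for k ≥ 1).
-- So an SCD of 2^[m] with L chains of length ≥ 2 has 2^L "liftings" to SCDs of 2^[m+1], and two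
-- different liftings are different decompositions, since they split some prism differently.
-- Always splitting the standard way, starting from 2^[0], gives de Bruijn's SCD 'std m'.
-- Its number of chains T satisfies 4^m ≤ T² (1 + 3m): apply Cauchy–Schwarz to the power sums
-- Σ|C| = 2^m and Σ|C|³ = 2^m (1 + 3m), both computed along the recursion.  Every chain of
-- 'std m' gives a chain of length ≥ 2 of 'std (m+1)', so 2^[m+2] has at least 2^T SCDs, and
-- T ≥ 2^m / √(1 + 3m) yields the theorem with c = 1/7.

open import Defs
open import Data.Nat using (ℕ; zero; suc; _+_; _*_; _≤_; _<_; _^_; z≤n; s≤s; _≤?_)
open import Data.Nat.Base using (>-nonZero)
open import Data.Nat.Properties
open import Data.Nat.Tactic.RingSolver using (solve-∀)
open import Data.List using (List; []; _∷_; length; concat; map; _++_)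
open import Data.Nat.ListAction using (sum)
open import Data.List.Properties using (length-map; length-++; map-++; ++-assoc; map-cong)
open import Data.Vec using ([]; _∷_; here; there)
open import Data.Fin using (zero; suc)
open import Data.Fin.Subset using (Subset; _⊂_; ∣_∣; inside; outside)
open import Data.Product using (_×_; Σ; _,_; proj₁; proj₂)
open import Data.Sum using (inj₁; inj₂)
open import Data.Unit using (tt)
open import Data.Empty using (⊥; ⊥-elim)
open import Function using (_∘_)
open import Function.Bundles using (Equivalence)
open import Relation.Nullary using (¬_; yes; no)
open import Relation.Binary.PropositionalEquality
open import Data.List.Relation.Unary.All as All using (All; []; _∷_)
import Data.List.Relation.Unary.All.Properties as All
open import Data.List.Relation.Unary.AllPairs as AllPairs using (AllPairs; []; _∷_)
import Data.List.Relation.Unary.AllPairs.Properties as AllPairs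
open import Data.List.Relation.Unary.Any using (here; there)
open import Data.List.Relation.Unary.Unique.Propositional using (Unique)
import Data.List.Relation.Unary.Unique.Propositional.Properties as Unique
open import Data.List.Relation.Binary.Permutation.Propositional
  using (_↭_; prep; ↭-sym; ↭-trans; ↭-reflexive; ↭⇒↭ₛ; module PermutationReasoning)
open import Data.List.Relation.Binary.Permutation.Propositional.Properties
  using (shift; shifts; ++-comm; ++⁺; ++⁺ˡ; ∈-resp-↭)
import Data.List.Relation.Binary.Permutation.Setoid.Properties as PermutationSetoid
open import Data.List.Membership.Propositional using (_∈_)
open import Data.List.Membership.Propositional.Properties
  using (∈-++⁺ˡ; ∈-++⁺ʳ; ∈-map⁺; ∈-map⁻; ∈-concat⁺′)

private variable
  A : Set
  m n k i : ℕ

lift₀ lift₁ : Subset m → Subset (suc m)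
lift₀ x = outside ∷ x
lift₁ x = inside ∷ x

lift₀⊂lift₁ : (x : Subset m) → lift₀ x ⊂ lift₁ x
lift₀⊂lift₁ x = (λ { (there p) → there p }) , (zero , here , λ ())

∷-⊂ : ∀ b {x y : Subset m} → x ⊂ y → (b ∷ x) ⊂ (b ∷ y)
∷-⊂ b (x⊆y , (j , j∈y , j∉x)) =
  (λ { here → here ; (there p) → there (x⊆y p) }) , (suc j , there j∈y , λ { (there p) → j∉x p })

map-chain : (f : Subset m → Subset n) → (∀ {x y} → x ⊂ y → f x ⊂ f y) →
            (cs : List (Subset m)) → IsChain cs → IsChain (map f cs)
map-chain f mono []           _        = tt
map-chain f mono (c ∷ [])     _        = tt
map-chain f mono (c ∷ d ∷ ds) (c⊂d , ch) = mono c⊂d , map-chain f mono (d ∷ ds) ch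

standardLong standardShort : Subset m → List (Subset m) → List (Subset (suc m))
standardLong c []       = lift₀ c ∷ lift₁ c ∷ []
standardLong c (d ∷ ds) = lift₀ c ∷ standardLong d ds
standardShort c []       = []
standardShort c (d ∷ ds) = lift₁ c ∷ standardShort d ds

twistedLong : Subset m → List (Subset m) → List (Subset (suc m))
twistedLong c cs = lift₀ c ∷ map lift₁ (c ∷ cs)

twistedShort : List (Subset m) → List (Subset (suc m))
twistedShort cs = map lift₀ cs

length-standardLong : ∀ (c : Subset m) cs → length (standardLong c cs) ≡ suc (suc (length cs))
length-standardLong c []       = refl
length-standardLong c (d ∷ ds) = cong suc (length-standardLong d ds)

length-standardShort : ∀ (c : Subset m) cs → length (standardShort c cs) ≡ length cs
length-standardShort c []       = refl
length-standardShort c (d ∷ ds) = cong suc (length-standardShort d ds)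

chain-standardLong : ∀ (c : Subset m) cs → IsChain (c ∷ cs) → IsChain (standardLong c cs)
chain-standardLong c []           _          = lift₀⊂lift₁ c , tt
chain-standardLong c (d ∷ [])     (c⊂d , _)  = ∷-⊂ outside c⊂d , lift₀⊂lift₁ d , tt
chain-standardLong c (d ∷ e ∷ es) (c⊂d , ch) = ∷-⊂ outside c⊂d , chain-standardLong d (e ∷ es) ch

chain-standardShort : ∀ (c : Subset m) cs → IsChain (c ∷ cs) → IsChain (standardShort c cs)
chain-standardShort c []           _          = tt
chain-standardShort c (d ∷ [])     _          = tt
chain-standardShort c (d ∷ e ∷ es) (c⊂d , ch) = ∷-⊂ inside c⊂d , chain-standardShort d (e ∷ es) ch

-- An element x of a chain c₀ … c_k in 2^[m] at position i satisfies
-- 2|x| + k = m + 2i.  Passing to 2^[m+1], its lift gains 0 (lift₀) or 1 (lift₁) elements and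
-- the chain it lies in gets one element longer or shorter; these are the four cases that occur.
module SizeArithmetic (x k m i : ℕ) where

  lift₀-longer : 2 * x + k ≡ m + 2 * i → 2 * x + suc k ≡ suc m + 2 * i
  lift₀-longer h = trans (+-suc (2 * x) k) (cong suc h)

  lift₁-longer : 2 * x + k ≡ m + 2 * i → 2 * suc x + suc k ≡ suc m + 2 * suc i
  lift₁-longer h = begin
    2 * suc x + suc k           ≡⟨ expand x k ⟩
    3 + (2 * x + k)             ≡⟨ cong (3 +_) h ⟩
    3 + (m + 2 * i)             ≡⟨ collect m i ⟩
    suc m + 2 * suc i           ∎
    where
    open ≡-Reasoning
    expand : ∀ x k → 2 * suc x + suc k ≡ 3 + (2 * x + k)
    expand = solve-∀
    collect : ∀ m i → 3 + (m + 2 * i) ≡ suc m + 2 * suc i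
    collect = solve-∀

  lift₁-shorter : 2 * x + suc k ≡ m + 2 * i → 2 * suc x + k ≡ suc m + 2 * i
  lift₁-shorter h = trans (expand x k) (cong suc h)
    where
    expand : ∀ x k → 2 * suc x + k ≡ suc (2 * x + suc k)
    expand = solve-∀

  lift₀-shorter : 2 * x + suc k ≡ m + 2 * suc i → 2 * x + k ≡ suc m + 2 * i
  lift₀-shorter h = suc-injective (trans (sym (+-suc (2 * x) k)) (trans h (collect m i)))
    where
    collect : ∀ m i → m + 2 * suc i ≡ suc (suc m + 2 * i)
    collect = solve-∀

open SizeArithmetic

sizes-standardLong : ∀ (c : Subset m) cs → SizesFrom {m} k i (c ∷ cs) →
                     SizesFrom {suc m} (suc k) i (standardLong c cs)
sizes-standardLong {m} {k} {i} c [] (h , _) =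
  lift₀-longer (∣ c ∣) k m i h , lift₁-longer (∣ c ∣) k m i h , tt
sizes-standardLong {m} {k} {i} c (d ∷ ds) (h , sz) =
  lift₀-longer (∣ c ∣) k m i h , sizes-standardLong d ds sz

sizes-standardShort : ∀ (c : Subset m) cs → SizesFrom {m} (suc k) i (c ∷ cs) →
                      SizesFrom {suc m} k i (standardShort c cs)
sizes-standardShort c [] _ = tt
sizes-standardShort {m} {k} {i} c (d ∷ ds) (h , sz) =
  lift₁-shorter (∣ c ∣) k m i h , sizes-standardShort d ds sz

sizes-lift₁ : (cs : List (Subset m)) → SizesFrom {m} k i cs →
              SizesFrom {suc m} (suc k) (suc i) (map lift₁ cs)
sizes-lift₁ [] _ = tt
sizes-lift₁ {m} {k} {i} (c ∷ cs) (h , sz) = lift₁-longer (∣ c ∣) k m i h , sizes-lift₁ cs sz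

sizes-lift₀ : (cs : List (Subset m)) → SizesFrom {m} (suc k) (suc i) cs →
              SizesFrom {suc m} k i (map lift₀ cs)
sizes-lift₀ [] _ = tt
sizes-lift₀ {m} {k} {i} (c ∷ cs) (h , sz) = lift₀-shorter (∣ c ∣) k m i h , sizes-lift₀ cs sz

symmetric : ∀ (x : Subset n) xs → IsChain (x ∷ xs) → SizesFrom {n} k 0 (x ∷ xs) →
            k ≡ length xs → IsSymmetricChain (x ∷ xs)
symmetric x xs ch sz refl = ch , sz

symmetric-standardLong : ∀ (c : Subset m) cs → IsSymmetricChain (c ∷ cs) →
                         IsSymmetricChain (standardLong c cs)
symmetric-standardLong c [] (ch , sz) = chain-standardLong c [] ch , sizes-standardLong {i = 0} c [] sz
symmetric-standardLong c (d ∷ ds) (ch , sz) =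
  symmetric (lift₀ c) (standardLong d ds) (chain-standardLong c (d ∷ ds) ch)
    (sizes-standardLong c (d ∷ ds) sz) (sym (length-standardLong d ds))

symmetric-standardShort : ∀ (c d : Subset m) ds → IsSymmetricChain (c ∷ d ∷ ds) →
                          IsSymmetricChain (standardShort c (d ∷ ds))
symmetric-standardShort c d ds (ch , sz) =
  symmetric (lift₁ c) (standardShort d ds) (chain-standardShort c (d ∷ ds) ch)
    (sizes-standardShort c (d ∷ ds) sz) (sym (length-standardShort d ds))

symmetric-twistedLong : ∀ (c : Subset m) cs → IsSymmetricChain (c ∷ cs) →
                        IsSymmetricChain (twistedLong c cs)
symmetric-twistedLong {m} c cs (ch , (h , sz)) =
  symmetric (lift₀ c) (map lift₁ (c ∷ cs))
    (lift₀⊂lift₁ c , map-chain lift₁ (∷-⊂ inside) (c ∷ cs) ch)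
    (lift₀-longer (∣ c ∣) _ m 0 h , sizes-lift₁ (c ∷ cs) (h , sz))
    (sym (length-map lift₁ (c ∷ cs)))

symmetric-twistedShort : ∀ (c d : Subset m) ds → IsSymmetricChain (c ∷ d ∷ ds) →
                         IsSymmetricChain (twistedShort (d ∷ ds))
symmetric-twistedShort c d ds ((_ , ch) , (_ , sz)) =
  symmetric (lift₀ d) (map lift₀ ds) (map-chain lift₀ (∷-⊂ outside) (d ∷ ds) ch)
    (sizes-lift₀ (d ∷ ds) sz) (sym (length-map lift₀ ds))

prism : List (Subset m) → List (Subset (suc m))
prism xs = map lift₀ xs ++ map lift₁ xs

standard-↭ : ∀ (c : Subset m) cs → standardLong c cs ++ standardShort c cs ↭ prism (c ∷ cs)
standard-↭ c []       = ↭-reflexive refl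
standard-↭ c (d ∷ ds) = prep (lift₀ c) (begin
  standardLong d ds ++ lift₁ c ∷ standardShort d ds  ↭⟨ shift (lift₁ c) (standardLong d ds) _ ⟩
  lift₁ c ∷ standardLong d ds ++ standardShort d ds  ↭⟨ prep (lift₁ c) (standard-↭ d ds) ⟩
  lift₁ c ∷ prism (d ∷ ds)                           ↭⟨ ↭-sym (shift (lift₁ c) (map lift₀ (d ∷ ds)) _) ⟩
  map lift₀ (d ∷ ds) ++ map lift₁ (c ∷ d ∷ ds)       ∎)
  where open PermutationReasoning

twisted-↭ : ∀ (c : Subset m) cs → twistedLong c cs ++ twistedShort cs ↭ prism (c ∷ cs)
twisted-↭ c cs = prep (lift₀ c) (++-comm (map lift₁ (c ∷ cs)) (map lift₀ cs))

prism-++ : (xs ys : List (Subset m)) → prism xs ++ prism ys ↭ prism (xs ++ ys)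
prism-++ xs ys = begin
  (map lift₀ xs ++ map lift₁ xs) ++ (map lift₀ ys ++ map lift₁ ys)
    ↭⟨ ↭-reflexive (++-assoc (map lift₀ xs) _ _) ⟩
  map lift₀ xs ++ (map lift₁ xs ++ map lift₀ ys ++ map lift₁ ys)
    ↭⟨ ++⁺ˡ (map lift₀ xs) (shifts (map lift₁ xs) (map lift₀ ys)) ⟩
  map lift₀ xs ++ (map lift₀ ys ++ map lift₁ xs ++ map lift₁ ys)
    ↭⟨ ↭-reflexive (sym (++-assoc (map lift₀ xs) _ _)) ⟩
  (map lift₀ xs ++ map lift₀ ys) ++ (map lift₁ xs ++ map lift₁ ys)
    ≡⟨ sym (cong₂ _++_ (map-++ lift₀ xs ys) (map-++ lift₁ xs ys)) ⟩
  prism (xs ++ ys) ∎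
  where open PermutationReasoning

prism-++⁺ : ∀ xs {ys : List (Subset m)} {P Q} → P ↭ prism xs → Q ↭ prism ys → P ++ Q ↭ prism (xs ++ ys)
prism-++⁺ xs {ys} P↭ Q↭ = ↭-trans (++⁺ P↭ Q↭) (prism-++ xs ys)

lift₀-lift₁-disjoint : (xs ys : List (Subset m)) → ∀ {z} → ¬ (z ∈ map lift₀ xs × z ∈ map lift₁ ys)
lift₀-lift₁-disjoint xs ys (z∈xs⁰ , z∈ys¹) with ∈-map⁻ lift₀ z∈xs⁰ | ∈-map⁻ lift₁ z∈ys¹
... | _ , _ , refl | _ , _ , ()

unique-prism : (xs : List (Subset m)) → Unique xs → Unique (prism xs)
unique-prism {m} xs u =
  Unique.++⁺ (Unique.map⁺ (lift-injective outside) u) (Unique.map⁺ (lift-injective inside) u)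
             (lift₀-lift₁-disjoint xs xs)
  where
  lift-injective : ∀ b {x y : Subset m} → b ∷ x ≡ b ∷ y → x ≡ y
  lift-injective b refl = refl

prism-covers : (xs : List (Subset m)) → (∀ x → x ∈ xs) → ∀ z → z ∈ prism xs
prism-covers xs cover (outside ∷ x) = ∈-++⁺ˡ (∈-map⁺ lift₀ (cover x))
prism-covers xs cover (inside ∷ x)  = ∈-++⁺ʳ (map lift₀ xs) (∈-map⁺ lift₁ (cover x))

-- 'Lifting E D': D is obtained from the chain family E of 2^[m] by splitting the prism over
-- each chain of E in one of the allowed ways (a chain with one element has only one split;
-- empty chains, which no SCD contains, are dropped).
data Lifting {m} : List (List (Subset m)) → List (List (Subset (suc m))) → Set where
  []       : Lifting [] []
  skip     : ∀ {E D} → Lifting E D → Lifting ([] ∷ E) D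
  single   : ∀ {E D} c → Lifting E D → Lifting ((c ∷ []) ∷ E) (standardLong c [] ∷ D)
  standard : ∀ {E D} c d ds → Lifting E D →
             Lifting ((c ∷ d ∷ ds) ∷ E) (standardLong c (d ∷ ds) ∷ standardShort c (d ∷ ds) ∷ D)
  twisted  : ∀ {E D} c d ds → Lifting E D →
             Lifting ((c ∷ d ∷ ds) ∷ E) (twistedLong c (d ∷ ds) ∷ twistedShort (d ∷ ds) ∷ D)

lifting-symmetric : ∀ {E : List (List (Subset m))} {D} → Lifting E D →
                    All IsSymmetricChain E → All IsSymmetricChain D
lifting-symmetric []                      []            = []
lifting-symmetric (skip l)                (() ∷ _)
lifting-symmetric (single c l)            (sym-C ∷ sym-E) =
  symmetric-standardLong c [] sym-C ∷ lifting-symmetric l sym-E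
lifting-symmetric (standard c d ds l)     (sym-C ∷ sym-E) =
  symmetric-standardLong c (d ∷ ds) sym-C ∷ symmetric-standardShort c d ds sym-C ∷
  lifting-symmetric l sym-E
lifting-symmetric (twisted c d ds l)      (sym-C ∷ sym-E) =
  symmetric-twistedLong c (d ∷ ds) sym-C ∷ symmetric-twistedShort c d ds sym-C ∷
  lifting-symmetric l sym-E

lifting-↭ : ∀ {E : List (List (Subset m))} {D} → Lifting E D → concat D ↭ prism (concat E)
lifting-↭ []                  = ↭-reflexive refl
lifting-↭ (skip l)            = lifting-↭ l
lifting-↭ (single c l)        = prism-++⁺ (c ∷ []) (↭-reflexive refl) (lifting-↭ l)
lifting-↭ (standard c d ds l) = ↭-trans (↭-reflexive (sym (++-assoc (standardLong c (d ∷ ds)) _ _)))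
  (prism-++⁺ (c ∷ d ∷ ds) (standard-↭ c (d ∷ ds)) (lifting-↭ l))
lifting-↭ (twisted c d ds l)  = ↭-trans (↭-reflexive (sym (++-assoc (twistedLong c (d ∷ ds)) _ _)))
  (prism-++⁺ (c ∷ d ∷ ds) (twisted-↭ c (d ∷ ds)) (lifting-↭ l))

lifting-SCD : ∀ {E : List (List (Subset m))} {D} → Lifting E D → IsSCD E → IsSCD D
lifting-SCD {E = E} {D} l (symmetric-E , unique-E , cover-E) =
  lifting-symmetric l symmetric-E ,
  PermutationSetoid.Unique-resp-↭ (setoid _) (↭⇒↭ₛ prism↭D) (unique-prism (concat E) unique-E) ,
  λ z → ∈-resp-↭ prism↭D (prism-covers (concat E) cover-E z)
  where
  prism↭D : prism (concat E) ↭ concat D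
  prism↭D = ↭-sym (lifting-↭ l)

standardLift : List (List (Subset m)) → List (List (Subset (suc m)))
standardLift []                   = []
standardLift ([] ∷ E)             = standardLift E
standardLift ((c ∷ []) ∷ E)       = standardLong c [] ∷ standardLift E
standardLift ((c ∷ d ∷ ds) ∷ E)   =
  standardLong c (d ∷ ds) ∷ standardShort c (d ∷ ds) ∷ standardLift E

standardLift-lifting : (E : List (List (Subset m))) → Lifting E (standardLift E)
standardLift-lifting []                 = []
standardLift-lifting ([] ∷ E)           = skip (standardLift-lifting E)
standardLift-lifting ((c ∷ []) ∷ E)     = single c (standardLift-lifting E)
standardLift-lifting ((c ∷ d ∷ ds) ∷ E) = standard c d ds (standardLift-lifting E)

std : ∀ m → List (List (Subset m))
std zero    = ([] ∷ []) ∷ []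
std (suc m) = standardLift (std m)

std-SCD : ∀ m → IsSCD (std m)
std-SCD zero    = ((tt , refl , tt) ∷ []) , ([] ∷ []) , λ { [] → here refl }
std-SCD (suc m) = lifting-SCD (standardLift-lifting (std m)) (std-SCD m)

-- The number of chains with at least two elements: the ones with two possible splits.
longChains : List (List A) → ℕ
longChains []                 = 0
longChains ([] ∷ E)           = longChains E
longChains ((c ∷ []) ∷ E)     = longChains E
longChains ((c ∷ d ∷ ds) ∷ E) = suc (longChains E)

liftings : List (List (Subset m)) → List (List (List (Subset (suc m))))
liftings []                 = [] ∷ []
liftings ([] ∷ E)           = liftings E
liftings ((c ∷ []) ∷ E)     = map (standardLong c [] ∷_) (liftings E)
liftings ((c ∷ d ∷ ds) ∷ E) =
  map (λ D → standardLong c (d ∷ ds) ∷ standardShort c (d ∷ ds) ∷ D) (liftings E) ++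
  map (λ D → twistedLong c (d ∷ ds) ∷ twistedShort (d ∷ ds) ∷ D) (liftings E)

liftings-are-liftings : (E : List (List (Subset m))) → All (Lifting E) (liftings E)
liftings-are-liftings []                 = [] ∷ []
liftings-are-liftings ([] ∷ E)           = All.map skip (liftings-are-liftings E)
liftings-are-liftings ((c ∷ []) ∷ E)     = All.map⁺ (All.map (single c) (liftings-are-liftings E))
liftings-are-liftings ((c ∷ d ∷ ds) ∷ E) =
  All.++⁺ (All.map⁺ (All.map (standard c d ds) (liftings-are-liftings E)))
          (All.map⁺ (All.map (twisted c d ds) (liftings-are-liftings E)))

length-liftings : (E : List (List (Subset m))) → length (liftings E) ≡ 2 ^ longChains E
length-liftings []                 = refl
length-liftings ([] ∷ E)           = length-liftings E
length-liftings ((c ∷ []) ∷ E)     = trans (length-map _ (liftings E)) (length-liftings E)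
length-liftings ((c ∷ d ∷ ds) ∷ E) = begin
  length (map _ (liftings E) ++ map _ (liftings E))       ≡⟨ length-++ (map _ (liftings E)) ⟩
  length (map _ (liftings E)) + length (map _ (liftings E))
    ≡⟨ cong₂ _+_ (length-map _ (liftings E)) (length-map _ (liftings E)) ⟩
  length (liftings E) + length (liftings E)               ≡⟨ cong (λ t → t + t) (length-liftings E) ⟩
  2 ^ longChains E + 2 ^ longChains E                     ≡⟨ cong (2 ^ longChains E +_) (sym (+-identityʳ _)) ⟩
  2 ^ suc (longChains E)                                  ∎
  where open ≡-Reasoning

record Distinguished (D₁ D₂ : List (List A)) : Set where
  constructor distinguished
  field
    {point}          : A
    {chain₁ chain₂}  : List A
    chain₁∈D₁        : chain₁ ∈ D₁
    chain₂∈D₂        : chain₂ ∈ D₂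
    point∈chain₁     : point ∈ chain₁
    point∈chain₂     : point ∈ chain₂
    chains-different : chain₁ ≢ chain₂

unique-++-right : ∀ (xs : List A) {ys} → Unique (xs ++ ys) → Unique ys
unique-++-right []       u       = u
unique-++-right (_ ∷ xs) (_ ∷ u) = unique-++-right xs u

unique-++-disjoint : ∀ (xs : List A) {ys x} → Unique (xs ++ ys) → x ∈ xs → x ∈ ys → ⊥
unique-++-disjoint (z ∷ xs) (z∉ ∷ _) (here refl) x∈ys = All.lookup (All.++⁻ʳ xs z∉) x∈ys refl
unique-++-disjoint (z ∷ xs) (_ ∷ u)  (there x∈xs) x∈ys = unique-++-disjoint xs u x∈xs x∈ys

chains-meet-once : ∀ (D : List (List A)) {C₁ C₂ x} → Unique (concat D) → C₁ ∈ D → C₂ ∈ D →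
                   x ∈ C₁ → x ∈ C₂ → C₁ ≡ C₂
chains-meet-once (C ∷ D) u (here refl) (here refl) _ _ = refl
chains-meet-once (C ∷ D) u (here refl) (there C₂∈D) x∈C x∈C₂ =
  ⊥-elim (unique-++-disjoint C u x∈C (∈-concat⁺′ x∈C₂ C₂∈D))
chains-meet-once (C ∷ D) u (there C₁∈D) (here refl) x∈C₁ x∈C =
  ⊥-elim (unique-++-disjoint C u x∈C (∈-concat⁺′ x∈C₁ C₁∈D))
chains-meet-once (C ∷ D) u (there C₁∈D) (there C₂∈D) x∈C₁ x∈C₂ =
  chains-meet-once D (unique-++-right C u) C₁∈D C₂∈D x∈C₁ x∈C₂

distinguished⇒different : ∀ {D₁ D₂ : List (List (Subset n))} → Unique (concat D₂) →
                          Distinguished D₁ D₂ → ¬ SameDecomposition D₁ D₂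
distinguished⇒different {D₂ = D₂} u (distinguished C₁∈D₁ C₂∈D₂ x∈C₁ x∈C₂ C₁≢C₂) same =
  C₁≢C₂ (chains-meet-once D₂ u (Equivalence.to (same _) C₁∈D₁) C₂∈D₂ x∈C₁ x∈C₂)

distinguished-∷ : ∀ {D₁ D₂ : List (List A)} C₁ C₂ → Distinguished D₁ D₂ →
                  Distinguished (C₁ ∷ D₁) (C₂ ∷ D₂)
distinguished-∷ _ _ (distinguished C₁∈D₁ C₂∈D₂ x∈C₁ x∈C₂ C₁≢C₂) =
  distinguished (there C₁∈D₁) (there C₂∈D₂) x∈C₁ x∈C₂ C₁≢C₂

-- The two splits of a long chain c ∷ d ∷ … are told apart by c⁰: after it the standard long
-- chain continues with d⁰, the twisted one with c¹.
standard-vs-twisted : ∀ (c d : Subset m) ds D D′ →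
  Distinguished (standardLong c (d ∷ ds) ∷ standardShort c (d ∷ ds) ∷ D)
                (twistedLong c (d ∷ ds) ∷ twistedShort (d ∷ ds) ∷ D′)
standard-vs-twisted c d ds D D′ =
  distinguished (here refl) (here refl) (here refl) (here refl) (long-chains-differ ds)
  where
  long-chains-differ : ∀ ds → standardLong c (d ∷ ds) ≢ twistedLong c (d ∷ ds)
  long-chains-differ []      ()
  long-chains-differ (_ ∷ _) ()

liftings-distinguished : (E : List (List (Subset m))) → AllPairs Distinguished (liftings E)
liftings-distinguished []                 = [] ∷ []
liftings-distinguished ([] ∷ E)           = liftings-distinguished E
liftings-distinguished ((c ∷ []) ∷ E)     =
  AllPairs.map⁺ (AllPairs.map (distinguished-∷ _ _) (liftings-distinguished E))
liftings-distinguished ((c ∷ d ∷ ds) ∷ E) = AllPairs.++⁺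
  (AllPairs.map⁺ (AllPairs.map (distinguished-∷ _ _ ∘ distinguished-∷ _ _) (liftings-distinguished E)))
  (AllPairs.map⁺ (AllPairs.map (distinguished-∷ _ _ ∘ distinguished-∷ _ _) (liftings-distinguished E)))
  (All.map⁺ (All.universal (λ D → All.map⁺ (All.universal (standard-vs-twisted c d ds D) _)) _))

allPairs-strengthen : ∀ {P : A → Set} {R S : A → A → Set} → (∀ {x y} → P y → R x y → S x y) →
                      ∀ {xs} → All P xs → AllPairs R xs → AllPairs S xs
allPairs-strengthen f []        []          = []
allPairs-strengthen f (_ ∷ Pxs) (Rx ∷ Rxs) =
  All.zipWith (λ (Py , Rxy) → f Py Rxy) (Pxs , Rx) ∷ allPairs-strengthen f Pxs Rxs

liftings-distinct : (E : List (List (Subset m))) → IsSCD E → DistinctSCDs (liftings E)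
liftings-distinct E scd =
  scds , allPairs-strengthen (λ scd-D → distinguished⇒different (proj₁ (proj₂ scd-D)))
                             scds (liftings-distinguished E)
  where
  scds : All IsSCD (liftings E)
  scds = All.map (λ l → lifting-SCD l scd) (liftings-are-liftings E)

-- Every nonempty chain of E yields a long chain of its standard lifting, so the standard
-- lifting of 'std m' has at least as many long chains as 'std m' has chains.
longChains-≤-∷ : ∀ (C : List A) R → longChains R ≤ longChains (C ∷ R)
longChains-≤-∷ []           R = ≤-refl
longChains-≤-∷ (c ∷ [])     R = ≤-refl
longChains-≤-∷ (c ∷ d ∷ ds) R = n≤1+n _

longChains-standardLong : ∀ (c : Subset m) cs R →
                          longChains (standardLong c cs ∷ R) ≡ suc (longChains R)
longChains-standardLong c []       R = refl
longChains-standardLong c (d ∷ []) R = refl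
longChains-standardLong c (d ∷ _ ∷ _) R = refl

chains-≤-longChains : (E : List (List (Subset m))) → All IsSymmetricChain E →
                      length E ≤ longChains (standardLift E)
chains-≤-longChains []                 _         = z≤n
chains-≤-longChains ([] ∷ E)           (() ∷ _)
chains-≤-longChains ((c ∷ []) ∷ E)     (_ ∷ sym-E) = s≤s (chains-≤-longChains E sym-E)
chains-≤-longChains ((c ∷ d ∷ ds) ∷ E) (_ ∷ sym-E) = begin
  suc (length E)                                       ≤⟨ s≤s (chains-≤-longChains E sym-E) ⟩
  suc (longChains (standardLift E))                    ≤⟨ s≤s (longChains-≤-∷ (standardShort c (d ∷ ds)) _) ⟩
  suc (longChains (standardShort c (d ∷ ds) ∷ standardLift E))
    ≡⟨ longChains-standardLong c (d ∷ ds) _ ⟨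
  longChains (standardLift ((c ∷ d ∷ ds) ∷ E))         ∎
  where open ≤-Reasoning

sum-map-+ : ∀ (f g : A → ℕ) xs → sum (map (λ x → f x + g x) xs) ≡ sum (map f xs) + sum (map g xs)
sum-map-+ f g []       = refl
sum-map-+ f g (x ∷ xs) =
  trans (cong (f x + g x +_) (sum-map-+ f g xs)) (interchange (f x) (g x) _ _)
  where
  interchange : ∀ a b s t → a + b + (s + t) ≡ a + s + (b + t)
  interchange = solve-∀

sum-map-* : ∀ k (f : A → ℕ) xs → sum (map (λ x → k * f x) xs) ≡ k * sum (map f xs)
sum-map-* k f []       = sym (*-zeroʳ k)
sum-map-* k f (x ∷ xs) =
  trans (cong (k * f x +_) (sum-map-* k f xs)) (sym (*-distribˡ-+ k (f x) _))

sum-ones : (xs : List A) → sum (map (λ _ → 1) xs) ≡ length xs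
sum-ones []       = refl
sum-ones (x ∷ xs) = cong suc (sum-ones xs)

-- Power sums along the standard lifting: a chain of length ℓ splits into chains of lengths
-- ℓ + 1 and ℓ − 1 (the latter absent when ℓ = 1).
sum-standardLift : (g h : ℕ → ℕ) → g 0 ≡ 0 → h 0 ≡ 0 → (∀ ℓ → h (suc ℓ) ≡ g (suc (suc ℓ)) + g ℓ) →
                   (E : List (List (Subset m))) →
                   sum (map (g ∘ length) (standardLift E)) ≡ sum (map (h ∘ length) E)
sum-standardLift g h g0 h0 step [] = refl
sum-standardLift g h g0 h0 step ([] ∷ E) =
  trans (sum-standardLift g h g0 h0 step E) (cong (_+ sum (map (h ∘ length) E)) (sym h0))
sum-standardLift g h g0 h0 step ((c ∷ []) ∷ E) = cong₂ _+_
  (trans (sym (+-identityʳ (g 2))) (trans (cong (g 2 +_) (sym g0)) (sym (step 0))))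
  (sum-standardLift g h g0 h0 step E)
sum-standardLift g h g0 h0 step ((c ∷ d ∷ ds) ∷ E) = begin
  g (length (standardLong c (d ∷ ds))) + (g (length (standardShort c (d ∷ ds))) + rest)
    ≡⟨ +-assoc (g (length (standardLong c (d ∷ ds)))) _ rest ⟨
  g (length (standardLong c (d ∷ ds))) + g (length (standardShort c (d ∷ ds))) + rest
    ≡⟨ cong (_+ rest) (cong₂ (λ u v → g u + g v)
         (length-standardLong c (d ∷ ds)) (length-standardShort c (d ∷ ds))) ⟩
  g (suc (suc (suc (length ds)))) + g (suc (length ds)) + rest
    ≡⟨ cong₂ _+_ (sym (step (suc (length ds)))) (sum-standardLift g h g0 h0 step E) ⟩
  h (suc (suc (length ds))) + sum (map (h ∘ length) E) ∎
  where
  open ≡-Reasoning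
  rest : ℕ
  rest = sum (map (g ∘ length) (standardLift E))

cube : ℕ → ℕ
cube x = x * (x * x)

-- The chains of 'std m' have Σ|C| = 2^m elements in total (they partition 2^[m]) ...
sum-lengths-std : ∀ m → sum (map length (std m)) ≡ 2 ^ m
sum-lengths-std zero    = refl
sum-lengths-std (suc m) = begin
  sum (map length (standardLift (std m)))   ≡⟨ sum-standardLift (λ ℓ → ℓ) (2 *_) refl refl step (std m) ⟩
  sum (map (λ C → 2 * length C) (std m))    ≡⟨ sum-map-* 2 length (std m) ⟩
  2 * sum (map length (std m))              ≡⟨ cong (2 *_) (sum-lengths-std m) ⟩
  2 ^ suc m                                 ∎
  where
  open ≡-Reasoning
  step : ∀ ℓ → 2 * suc ℓ ≡ suc (suc ℓ) + ℓ
  step = solve-∀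

sum-cubes-std : ∀ m → sum (map (cube ∘ length) (std m)) ≡ 2 ^ m * (1 + 3 * m)
sum-cubes-std zero    = refl
sum-cubes-std (suc m) = begin
  sum (map (cube ∘ length) (standardLift (std m)))
    ≡⟨ sum-standardLift cube (λ ℓ → 2 * cube ℓ + 6 * ℓ) refl refl step (std m) ⟩
  sum (map (λ C → 2 * cube (length C) + 6 * length C) (std m))
    ≡⟨ sum-map-+ (λ C → 2 * cube (length C)) (λ C → 6 * length C) (std m) ⟩
  sum (map (λ C → 2 * cube (length C)) (std m)) + sum (map (λ C → 6 * length C) (std m))
    ≡⟨ cong₂ _+_ (sum-map-* 2 (cube ∘ length) (std m)) (sum-map-* 6 length (std m)) ⟩
  2 * sum (map (cube ∘ length) (std m)) + 6 * sum (map length (std m))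
    ≡⟨ cong₂ (λ s₃ s₁ → 2 * s₃ + 6 * s₁) (sum-cubes-std m) (sum-lengths-std m) ⟩
  2 * (2 ^ m * (1 + 3 * m)) + 6 * 2 ^ m
    ≡⟨ collect (2 ^ m) m ⟩
  2 ^ suc m * (1 + 3 * suc m) ∎
  where
  open ≡-Reasoning
  -- 'cube' unfolded, so that the ring solver sees a polynomial identity
  step : ∀ ℓ → 2 * (suc ℓ * (suc ℓ * suc ℓ)) + 6 * suc ℓ
             ≡ suc (suc ℓ) * (suc (suc ℓ) * suc (suc ℓ)) + ℓ * (ℓ * ℓ)
  step = solve-∀
  collect : ∀ P m → 2 * (P * (1 + 3 * m)) + 6 * P ≡ 2 * P * (1 + 3 * suc m)
  collect = solve-∀

2ab≤a²+b² : ∀ a b → 2 * a * b ≤ a * a + b * b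
2ab≤a²+b² a b with ≤-total a b
... | inj₁ a≤b with d , refl ← m≤n⇒∃[o]m+o≡n a≤b =
  ≤-trans (m≤m+n (2 * a * (a + d)) (d * d)) (≤-reflexive (expand a d))
  where
  expand : ∀ a d → 2 * a * (a + d) + d * d ≡ a * a + (a + d) * (a + d)
  expand = solve-∀
... | inj₂ b≤a with d , refl ← m≤n⇒∃[o]m+o≡n b≤a =
  ≤-trans (m≤m+n (2 * (b + d) * b) (d * d)) (≤-reflexive (expand b d))
  where
  expand : ∀ b d → 2 * (b + d) * b + d * d ≡ (b + d) * (b + d) + b * b
  expand = solve-∀

module CauchySchwarz (w f : A → ℕ) where

  Σw Σwf Σwf² : List A → ℕ
  Σw   xs = sum (map w xs)
  Σwf  xs = sum (map (λ x → w x * f x) xs)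
  Σwf² xs = sum (map (λ x → w x * (f x * f x)) xs)

  -- The cross term, bounded termwise by 2ab ≤ a² + b².
  cross-term : ∀ y xs → 2 * y * Σwf xs ≤ y * y * Σw xs + Σwf² xs
  cross-term y [] = ≤-reflexive (vanish y)
    where
    vanish : ∀ y → 2 * y * 0 ≡ y * y * 0 + 0
    vanish = solve-∀
  cross-term y (x ∷ xs) = begin
    2 * y * (w x * f x + Σwf xs)                          ≡⟨ distribute y (w x) (f x) (Σwf xs) ⟩
    w x * (2 * y * f x) + 2 * y * Σwf xs
      ≤⟨ +-mono-≤ (*-monoʳ-≤ (w x) (2ab≤a²+b² y (f x))) (cross-term y xs) ⟩
    w x * (y * y + f x * f x) + (y * y * Σw xs + Σwf² xs) ≡⟨ collect y (w x) (f x) (Σw xs) (Σwf² xs) ⟩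
    y * y * (w x + Σw xs) + (w x * (f x * f x) + Σwf² xs) ∎
    where
    open ≤-Reasoning
    distribute : ∀ y u v P → 2 * y * (u * v + P) ≡ u * (2 * y * v) + 2 * y * P
    distribute = solve-∀
    collect : ∀ y u v W Q → u * (y * y + v * v) + (y * y * W + Q) ≡ y * y * (u + W) + (u * (v * v) + Q)
    collect = solve-∀

  cauchy-schwarz : ∀ xs → Σwf xs * Σwf xs ≤ Σw xs * Σwf² xs
  cauchy-schwarz []       = ≤-refl
  cauchy-schwarz (x ∷ xs) = begin
    (w x * f x + Σwf xs) * (w x * f x + Σwf xs)
      ≡⟨ expand (w x) (f x) (Σwf xs) ⟩
    w x * w x * (f x * f x) + w x * (2 * f x * Σwf xs) + Σwf xs * Σwf xs
      ≤⟨ +-mono-≤ (+-monoʳ-≤ (w x * w x * (f x * f x)) (*-monoʳ-≤ (w x) (cross-term (f x) xs)))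
                  (cauchy-schwarz xs) ⟩
    w x * w x * (f x * f x) + w x * (f x * f x * Σw xs + Σwf² xs) + Σw xs * Σwf² xs
      ≡⟨ collect (w x) (f x) (Σw xs) (Σwf² xs) ⟩
    (w x + Σw xs) * (w x * (f x * f x) + Σwf² xs) ∎
    where
    open ≤-Reasoning
    expand : ∀ u v P → (u * v + P) * (u * v + P) ≡ u * u * (v * v) + u * (2 * v * P) + P * P
    expand = solve-∀
    collect : ∀ u v W Q → u * u * (v * v) + u * (v * v * W + Q) + W * Q ≡ (u + W) * (u * (v * v) + Q)
    collect = solve-∀

open CauchySchwarz using (cauchy-schwarz)

square-2^ : ∀ m → 2 ^ m * 2 ^ m ≡ 4 ^ m
square-2^ zero    = refl
square-2^ (suc m) = trans (regroup (2 ^ m)) (cong (4 *_) (square-2^ m))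
  where
  regroup : ∀ P → 2 * P * (2 * P) ≡ 4 * (P * P)
  regroup = solve-∀

-- With S₁ = Σ|C| = 2^m, S₂ = Σ|C|², S₃ = Σ|C|³ = 2^m (1 + 3m), Cauchy–Schwarz gives
-- S₁² ≤ T S₂ and S₂² ≤ S₁ S₃, whence S₁⁴ ≤ T² S₂² ≤ T² S₁² (1 + 3m).
chain-count-bound : ∀ m → 4 ^ m ≤ length (std m) * length (std m) * (1 + 3 * m)
chain-count-bound m = subst (_≤ T * T * K) (square-2^ m)
  (*-cancelʳ-≤ (P * P) (T * T * K) (P * P) {{>-nonZero (*-mono-< (m^n>0 2 m) (m^n>0 2 m))}} (begin
    P * P * (P * P)          ≤⟨ *-mono-≤ S₁²≤TS₂ S₁²≤TS₂ ⟩
    T * S₂ * (T * S₂)        ≡⟨ regroup₁ T S₂ ⟩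
    T * T * (S₂ * S₂)        ≤⟨ *-monoʳ-≤ (T * T) S₂²≤S₁S₃ ⟩
    T * T * (P * (P * K))    ≡⟨ regroup₂ T P K ⟩
    T * T * K * (P * P)      ∎))
  where
  open ≤-Reasoning
  E : List (List (Subset m))
  E = std m
  T P K S₂ : ℕ
  T  = length E
  P  = 2 ^ m
  K  = 1 + 3 * m
  S₂ = sum (map (λ C → length C * length C) E)
  S₁²≤TS₂ : P * P ≤ T * S₂
  S₁²≤TS₂ = subst₂ (λ S₁ R → S₁ * S₁ ≤ R)
    (trans (cong sum (map-cong (λ C → *-identityˡ (length C)) E)) (sum-lengths-std m))
    (cong₂ _*_ (sum-ones E) (cong sum (map-cong (λ C → *-identityˡ (length C * length C)) E)))
    (cauchy-schwarz (λ _ → 1) length E)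
  S₂²≤S₁S₃ : S₂ * S₂ ≤ P * (P * K)
  S₂²≤S₁S₃ = subst (S₂ * S₂ ≤_) (cong₂ _*_ (sum-lengths-std m) (sum-cubes-std m))
    (cauchy-schwarz length length E)
  regroup₁ : ∀ T S → T * S * (T * S) ≡ T * T * (S * S)
  regroup₁ = solve-∀
  regroup₂ : ∀ T P K → T * T * (P * (P * K)) ≡ T * T * K * (P * P)
  regroup₂ = solve-∀

square-reflects-≤ : ∀ a c → a * a ≤ c * c → a ≤ c
square-reflects-≤ a c a²≤c² with a ≤? c
... | yes a≤c = a≤c
... | no  a≰c = ⊥-elim (<⇒≱ (*-mono-< (≰⇒> a≰c) (≰⇒> a≰c)) a²≤c²)

-- The exponent estimate for n = m + 2 and c = 1/7: if a ≤ c 2^n/√n, i.e. 49 a² n ≤ b² 4^n,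
-- and 4^m ≤ L² (1 + 3m), then a ≤ b L, because 16 (1 + 3m) ≤ 49 n.
exponent-bound : ∀ m a b L → 4 ^ m ≤ L * L * (1 + 3 * m) →
                 a * a * (7 * 7) * suc (suc m) ≤ b * b * (1 * 1) * 4 ^ suc (suc m) → a ≤ b * L
exponent-bound m a b L 4^m≤L²K a-small =
  square-reflects-≤ a (b * L) (*-cancelʳ-≤ (a * a) (b * L * (b * L)) (49 * (2 + m)) (begin
    a * a * (49 * (2 + m))            ≡⟨ regroup₁ a (2 + m) ⟩
    a * a * (7 * 7) * (2 + m)         ≤⟨ a-small ⟩
    b * b * (1 * 1) * (4 ^ (2 + m))   ≡⟨ regroup₂ b (4 ^ m) ⟩
    b * b * (16 * 4 ^ m)              ≤⟨ *-monoʳ-≤ (b * b) (*-monoʳ-≤ 16 4^m≤L²K) ⟩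
    b * b * (16 * (L * L * K))        ≡⟨ regroup₃ b L K ⟩
    b * L * (b * L) * (16 * K)        ≤⟨ *-monoʳ-≤ (b * L * (b * L)) 16K≤49[2+m] ⟩
    b * L * (b * L) * (49 * (2 + m))  ∎))
  where
  open ≤-Reasoning
  K : ℕ
  K = 1 + 3 * m
  16K≤49[2+m] : 16 * K ≤ 49 * (2 + m)
  16K≤49[2+m] = ≤-trans (m≤m+n (16 * K) (82 + m)) (≤-reflexive (difference m))
    where
    difference : ∀ m → 16 * (1 + 3 * m) + (82 + m) ≡ 49 * (2 + m)
    difference = solve-∀
  regroup₁ : ∀ a n → a * a * (49 * n) ≡ a * a * (7 * 7) * n
  regroup₁ = solve-∀
  regroup₂ : ∀ b Q → b * b * (1 * 1) * (4 * (4 * Q)) ≡ b * b * (16 * Q)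
  regroup₂ = solve-∀
  regroup₃ : ∀ b L K → b * b * (16 * (L * L * K)) ≡ b * L * (b * L) * (16 * K)
  regroup₃ = solve-∀

exponent-monotone : ∀ a b L → a ≤ b * L → 2 ^ a ≤ (2 ^ L) ^ b
exponent-monotone a b L a≤bL = begin
  2 ^ a         ≤⟨ ^-monoʳ-≤ 2 (subst (a ≤_) (*-comm b L) a≤bL) ⟩
  2 ^ (L * b)   ≡⟨ ^-*-assoc 2 L b ⟨
  (2 ^ L) ^ b   ∎
  where open ≤-Reasoning

-- 2^[m+2] has 2^L pairwise different SCDs, namely the liftings of de Bruijn's SCD of 2^[m+1],
-- where L, its number of long chains, is at least the number T of chains of 'std m', so that
-- 4^m ≤ L² (1 + 3m).
many-SCDs : ∀ m → Σ (List (List (List (Subset (suc (suc m)))))) λ Ds → DistinctSCDs Ds ×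
            Σ ℕ λ L → length Ds ≡ 2 ^ L × 4 ^ m ≤ L * L * (1 + 3 * m)
many-SCDs m =
  liftings E , liftings-distinct E (std-SCD (suc m)) , longChains E , length-liftings E ,
  ≤-trans (chain-count-bound m) (*-monoˡ-≤ (1 + 3 * m) (*-mono-≤ T≤L T≤L))
  where
  E : List (List (Subset (suc m)))
  E = std (suc m)
  T≤L : length (std m) ≤ longChains E
  T≤L = chains-≤-longChains (std m) (proj₁ (std-SCD m))

proposition4p1 : Σ ℕ λ p → Σ ℕ λ q → 0 < p × 0 < q ×
    (∀ (n : ℕ) → 2 ≤ n →
    Σ (List (List (List (Subset n)))) λ Ds → DistinctSCDs Ds ×
    (∀ (a b : ℕ) → 0 < b →
    a * a * (q * q) * n ≤ b * b * (p * p) * (4 ^ n) →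
    2 ^ a ≤ length Ds ^ b))
proposition4p1 = 1 , 7 , s≤s z≤n , s≤s z≤n , λ where
  (suc zero) (s≤s ())
  (suc (suc m)) _ → let Ds , distinct , L , Ds≡2^L , 4^m≤L²K = many-SCDs m in
    Ds , distinct , λ a b _ a-small →
      subst (λ N → 2 ^ a ≤ N ^ b) (sym Ds≡2^L)
            (exponent-monotone a b L (exponent-bound m a b L 4^m≤L²K a-small))
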